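{- Let $G=(U,W,E)$ be a convex bipartite graph with $|U|\ge 2$ and $|W|\ge 2$, with convex ordering $w_1,\dots,w_{|W|}$ of $W$, and let $D$ be a minimal connected dominating set of $G$. Let $i,j\in U$ with $I_i\cap I_j\neq\emptyset$. If there is a vertex $k\in U\setminus\{i,j\}$ with $I_k\subsetneq I_i\cup I_j$ such that $i,j,k\in D\cap U$, then $I_i\cap I_j\cap D=\emptyset$.
   Context: All graphs are finite, undirected, simple. A bipartite graph $G=(U,W,E)$ is convex if there is an ordering $w_1,\dots,w_{|W|}$ of $W$ such that for every $u\in U$ the neighborhood $N(u)\subseteq W$ is a set of consecutive vertices $I_u$ in this ordering (the neighbor interval of $u$, viewed as a subset of $W$). A set $D\subseteq V(G)$ is a connected dominating set if $G[D]$ is connected and every vertex of $G$ is in $D$ or has a neighbor in $D$; it is minimal if no proper subset of it is a connected dominating set. -}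

module Defs where

open import Data.Nat using (ℕ)
open import Data.Fin using (Fin; _≤_)
open import Data.Bool using (Bool; true; false)
open import Data.Sum using (_⊎_; inj₁; inj₂)
open import Data.Product using (_×_; ∃; Σ)
open import Data.Empty using (⊥)
open import Relation.Binary.PropositionalEquality using (_≡_)

-- A bipartite graph G = (U, W, E) with U = Fin m, W = Fin n.
-- The edge relation is given by E u w ≡ true.
-- The order on W is the natural order of Fin n (this is the convex ordering w_1,...,w_n).
Vertex : ℕ → ℕ → Set
Vertex m n = Fin m ⊎ Fin n

IsConvex : {m n : ℕ} → (Fin m → Fin n → Bool) → Set
IsConvex {m} {n} E = ∀ (u : Fin m) (a b c : Fin n) → a ≤ b → b ≤ c →
  E u a ≡ true → E u c ≡ true → E u b ≡ true

Adj : {m n : ℕ} → (Fin m → Fin n → Bool) → Vertex m n → Vertex m n → Set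
Adj E (inj₁ u) (inj₁ u') = ⊥
Adj E (inj₁ u) (inj₂ w) = E u w ≡ true
Adj E (inj₂ w) (inj₁ u) = E u w ≡ true
Adj E (inj₂ w) (inj₂ w') = ⊥

VSet : ℕ → ℕ → Set
VSet m n = Vertex m n → Bool

data Reach {m n : ℕ} (E : Fin m → Fin n → Bool) (D : VSet m n) :
       Vertex m n → Vertex m n → Set where
  here : ∀ {x} → D x ≡ true → Reach E D x x
  step : ∀ {x y z} → Reach E D x y → Adj E y z → D z ≡ true → Reach E D x z

IsConnectedSet : {m n : ℕ} → (Fin m → Fin n → Bool) → VSet m n → Set
IsConnectedSet {m} {n} E D =
  ∀ (x y : Vertex m n) → D x ≡ true → D y ≡ true → Reach E D x y

IsDominating : {m n : ℕ} → (Fin m → Fin n → Bool) → VSet m n → Set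
IsDominating {m} {n} E D =
  ∀ (v : Vertex m n) → D v ≡ true ⊎ ∃ (λ x → Adj E v x × D x ≡ true)

IsCDS : {m n : ℕ} → (Fin m → Fin n → Bool) → VSet m n → Set
IsCDS E D = IsConnectedSet E D × IsDominating E D

ProperSubset : {m n : ℕ} → VSet m n → VSet m n → Set
ProperSubset {m} {n} D' D =
  (∀ (v : Vertex m n) → D' v ≡ true → D v ≡ true) ×
  ∃ (λ (v : Vertex m n) → D v ≡ true × D' v ≡ false)

IsMinimalCDS : {m n : ℕ} → (Fin m → Fin n → Bool) → VSet m n → Set
IsMinimalCDS {m} {n} E D =
  IsCDS E D × (∀ (D' : VSet m n) → ProperSubset D' D → IsCDS E D' → ⊥)

-- Suppose some w ∈ I_i ∩ I_j lies in D. Then D ∖ {k} is still a connected dominating set: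
-- every neighbour of k lies in I_i ∪ I_j, so it is dominated by i or j, and a walk through k
-- can be rerouted through i or j, which are joined by the path i – w – j. This contradicts
-- the minimality of D.
module Submission where

open import Defs
open import Data.Nat using (ℕ; _≥_)
open import Data.Fin using (Fin; _≟_)
open import Data.Bool using (Bool; true; false; if_then_else_)
open import Data.Sum using (_⊎_; inj₁; inj₂; [_,_]′)
open import Data.Product using (_×_; ∃; _,_)
open import Data.Empty using (⊥; ⊥-elim)
open import Relation.Nullary using (yes; no; does)
open import Relation.Binary.PropositionalEquality using (_≡_; _≢_; refl; sym)

_∖_ : ∀ {m n} → VSet m n → Fin m → VSet m n
(D ∖ k) (inj₁ u) = if does (u ≟ k) then false else D (inj₁ u)
(D ∖ k) (inj₂ w) = D (inj₂ w)

module _ {m n} (D : VSet m n) (k : Fin m) where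

  ∖-⊆ : ∀ v → (D ∖ k) v ≡ true → D v ≡ true
  ∖-⊆ (inj₁ u) h with u ≟ k
  ∖-⊆ (inj₁ u) () | yes _
  ... | no _ = h
  ∖-⊆ (inj₂ _) h = h

  ∖-keeps : ∀ {u} → u ≢ k → D (inj₁ u) ≡ true → (D ∖ k) (inj₁ u) ≡ true
  ∖-keeps {u} u≢k h with u ≟ k
  ... | yes u≡k = ⊥-elim (u≢k u≡k)
  ... | no _    = h

  ∖-removes : (D ∖ k) (inj₁ k) ≡ false
  ∖-removes with k ≟ k
  ... | yes _ = refl
  ... | no k≢k = ⊥-elim (k≢k refl)

  ∖-properSubset : D (inj₁ k) ≡ true → ProperSubset (D ∖ k) D
  ∖-properSubset dk = ∖-⊆ , inj₁ k , dk , ∖-removes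

module _ {m n : ℕ} (E : Fin m → Fin n → Bool) where

  Adj-sym : ∀ {x y : Vertex m n} → Adj E x y → Adj E y x
  Adj-sym {inj₁ _} {inj₂ _} a = a
  Adj-sym {inj₂ _} {inj₁ _} a = a

  Reach-target : ∀ {D : VSet m n} {x y} → Reach E D x y → D y ≡ true
  Reach-target (here d)     = d
  Reach-target (step _ _ d) = d

  Reach-trans : ∀ {D : VSet m n} {x y z} → Reach E D x y → Reach E D y z → Reach E D x z
  Reach-trans p (here _)     = p
  Reach-trans p (step q a d) = step (Reach-trans p q) a d

  Reach-sym : ∀ {D : VSet m n} {x y} → Reach E D x y → Reach E D y x
  Reach-sym (here d)     = here d
  Reach-sym (step p a d) = Reach-trans (step (here d) (Adj-sym a) (Reach-target p)) (Reach-sym p)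

  connected⇒neighbourInSet : ∀ {D : VSet m n} {x} {k : Fin m} → IsConnectedSet E D →
    D x ≡ true → D (inj₁ k) ≡ true → x ≢ inj₁ k →
    ∃ (λ w → E k w ≡ true × D (inj₂ w) ≡ true)
  connected⇒neighbourInSet {x = x} {k} conn dx dk x≢k with conn x (inj₁ k) dx dk
  ... | here _                    = ⊥-elim (x≢k refl)
  ... | step {y = inj₂ w} p a _   = w , a , Reach-target p

  module _ (D : VSet m n) (k : Fin m) where

    ∖-connected : IsConnectedSet E D → (r : Vertex m n) → (D ∖ k) r ≡ true →
      (∀ w → E k w ≡ true → D (inj₂ w) ≡ true → Reach E (D ∖ k) r (inj₂ w)) →
      IsConnectedSet E (D ∖ k)
    ∖-connected conn r dr viaK x y dx dy =
      Reach-trans (Reach-sym (reroute x (conn r x (∖-⊆ D k r dr) (∖-⊆ D k x dx)) dx))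
                  (reroute y (conn r y (∖-⊆ D k r dr) (∖-⊆ D k y dy)) dy)
      where
      reroute : ∀ y → Reach E D r y → (D ∖ k) y ≡ true → Reach E (D ∖ k) r y
      reroute _ (here _) d = here d
      reroute (inj₂ w) (step {y = inj₁ u} p a dw) d with u ≟ k
      ... | yes refl = viaK w a dw
      ... | no u≢k   = step (reroute (inj₁ u) p (∖-keeps D k u≢k (Reach-target p))) a d
      reroute (inj₁ _) (step {y = inj₂ w} p a _) d = step (reroute (inj₂ w) p (Reach-target p)) a d

    ∖-dominating : IsDominating E D →
      ∃ (λ w → E k w ≡ true × D (inj₂ w) ≡ true) →
      (∀ w → E k w ≡ true → ∃ (λ x → Adj E (inj₂ w) x × (D ∖ k) x ≡ true)) →
      IsDominating E (D ∖ k)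
    ∖-dominating dom (w , a , dw) coverK (inj₁ u) with u ≟ k
    ... | yes refl = inj₂ (inj₂ w , a , dw)
    ... | no _ with dom (inj₁ u)
    ...   | inj₁ du                  = inj₁ du
    ...   | inj₂ (inj₂ w' , a' , dw') = inj₂ (inj₂ w' , a' , dw')
    ∖-dominating dom _ coverK (inj₂ w) with dom (inj₂ w)
    ... | inj₁ dw = inj₁ dw
    ... | inj₂ (inj₁ u , a , du) with u ≟ k
    ...   | yes refl = inj₂ (coverK w a)
    ...   | no u≢k   = inj₂ (inj₁ u , a , ∖-keeps D k u≢k du)

  minimalCDS⇒∖-notCDS : ∀ {D k} → IsMinimalCDS E D → D (inj₁ k) ≡ true → IsCDS E (D ∖ k) → ⊥
  minimalCDS⇒∖-notCDS {D} {k} (_ , minimal) dk = minimal (D ∖ k) (∖-properSubset D k dk)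

mainTheorem6 : ∀ (m n : ℕ) → m ≥ 2 → n ≥ 2 →
    (E : Fin m → Fin n → Bool) → IsConvex E →
    (D : VSet m n) → IsMinimalCDS E D →
    (i j : Fin m) →
    ∃ (λ w → E i w ≡ true × E j w ≡ true) →
    (k : Fin m) → k ≢ i → k ≢ j →
    (∀ w → E k w ≡ true → E i w ≡ true ⊎ E j w ≡ true) →
    ∃ (λ w → (E i w ≡ true ⊎ E j w ≡ true) × E k w ≡ false) →
    D (inj₁ i) ≡ true → D (inj₁ j) ≡ true → D (inj₁ k) ≡ true →
    ∀ (w : Fin n) → E i w ≡ true → E j w ≡ true → D (inj₂ w) ≡ false
mainTheorem6 m n _ _ E _ D minimal@((conn , dom) , _) i j _ k k≢i k≢j Ik⊆Ii∪Ij _ di dj dk w Eiw Ejw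
  with D (inj₂ w) in dw
... | false = refl
... | true  = ⊥-elim (minimalCDS⇒∖-notCDS E minimal dk (connected , dominating))
  where
  di' : (D ∖ k) (inj₁ i) ≡ true
  di' = ∖-keeps D k (λ i≡k → k≢i (sym i≡k)) di
  dj' : (D ∖ k) (inj₁ j) ≡ true
  dj' = ∖-keeps D k (λ j≡k → k≢j (sym j≡k)) dj
  i⇝j : Reach E (D ∖ k) (inj₁ i) (inj₁ j)
  i⇝j = step (step {z = inj₂ w} (here di') Eiw dw) Ejw dj'
  connected : IsConnectedSet E (D ∖ k)
  connected = ∖-connected E D k conn (inj₁ i) di' λ w' Ekw' dw' → i⇝Ii∪Ij (Ik⊆Ii∪Ij w' Ekw') dw'
    where
    i⇝Ii∪Ij : ∀ {w'} → E i w' ≡ true ⊎ E j w' ≡ true → D (inj₂ w') ≡ true → Reach E (D ∖ k) (inj₁ i) (inj₂ w')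
    i⇝Ii∪Ij (inj₁ Eiw') dw' = step (here di') Eiw' dw'
    i⇝Ii∪Ij (inj₂ Ejw') dw' = step i⇝j Ejw' dw'
  dominating : IsDominating E (D ∖ k)
  dominating = ∖-dominating E D k dom
    (connected⇒neighbourInSet E conn di dk λ { refl → k≢i refl })
    λ w' Ekw' → [ (λ e → inj₁ i , e , di') , (λ e → inj₁ j , e , dj') ]′ (Ik⊆Ii∪Ij w' Ekw')
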